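{- For every computation $M$ and value $W$ of $\lambda_{\copyright}$: if $M (\to^{\mathsf w}_{\beta_c})^* !W$ then $M \mapsto_{\beta_c\sigma}^* !W$. Moreover, the two sequences have the same number of $\beta_c$ steps.
   Context: The computational core $\lambda_{\copyright}$ has values $V,W ::= x \mid \lambda x.M$ and computations $M,N,L ::= \,!V \mid VM$ ($x$ ranging over a countable set of variables, terms up to $\alpha$-renaming). Root rules on computations: $\beta_c$: $(\lambda x.M)(!V) \mapsto M\{V/x\}$; $\sigma$: $(\lambda y.N)((\lambda x.M)L) \mapsto (\lambda x.(\lambda y.N)M)L$ provided $x\notin \mathrm{fv}(N)$; $\mapsto_{\beta_c\sigma}=\mapsto_{\beta_c}\cup\mapsto_\sigma$ (the root rules with no contextual closure). Weak contexts $W ::= [\,]\mid VW$; $\to^{\mathsf w}_{\beta_c}$ is the closure of $\beta_c$ under weak contexts. $^*$ is reflexive–transitive closure. -}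

module Defs where

open import Data.Nat using (ℕ; zero; suc)
open import Data.Fin using (Fin; zero; suc)

-- Well-scoped de Bruijn syntax of λ© (terms up to α-renaming).
-- Val n / Comp n : values / computations with free variables among Fin n.
mutual
  data Val (n : ℕ) : Set where
    var : Fin n → Val n
    lam : Comp (suc n) → Val n

  data Comp (n : ℕ) : Set where
    ret : Val n → Comp n                -- !V
    app : Val n → Comp n → Comp n

Ren : ℕ → ℕ → Set
Ren m n = Fin m → Fin n

liftR : ∀ {m n} → Ren m n → Ren (suc m) (suc n)
liftR ρ zero    = zero
liftR ρ (suc i) = suc (ρ i)

mutual
  renV : ∀ {m n} → Ren m n → Val m → Val n
  renV ρ (var i) = var (ρ i)
  renV ρ (lam M) = lam (renC (liftR ρ) M)

  renC : ∀ {m n} → Ren m n → Comp m → Comp n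
  renC ρ (ret V)   = ret (renV ρ V)
  renC ρ (app V M) = app (renV ρ V) (renC ρ M)

Sub : ℕ → ℕ → Set
Sub m n = Fin m → Val n

liftS : ∀ {m n} → Sub m n → Sub (suc m) (suc n)
liftS σ zero    = var zero
liftS σ (suc i) = renV suc (σ i)

mutual
  subV : ∀ {m n} → Sub m n → Val m → Val n
  subV σ (var i) = σ i
  subV σ (lam M) = lam (subC (liftS σ) M)

  subC : ∀ {m n} → Sub m n → Comp m → Comp n
  subC σ (ret V)   = ret (subV σ V)
  subC σ (app V M) = app (subV σ V) (subC σ M)

-- single substitution M{V/x}, x being the variable bound at index 0
single : ∀ {n} → Val n → Sub (suc n) n
single V zero    = V
single V (suc i) = var i

_[_] : ∀ {n} → Comp (suc n) → Val n → Comp n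
M [ V ] = subC (single V) M

-- Root rules (no contextual closure).
-- βc : (λx.M)(!V) ↦ M{V/x}
data _↦βc_ {n : ℕ} : Comp n → Comp n → Set where
  βc : ∀ (M : Comp (suc n)) (V : Val n) → app (lam M) (ret V) ↦βc (M [ V ])

-- σ : (λy.N)((λx.M)L) ↦ (λx.(λy.N)M)L  with x ∉ fv(N).
-- In de Bruijn form the side condition is expressed by weakening N
-- (renC suc) under the new binder λx.
data _↦σ_ {n : ℕ} : Comp n → Comp n → Set where
  σ : ∀ (N : Comp (suc n)) (M : Comp (suc n)) (L : Comp n) →
      app (lam N) (app (lam M) L)
        ↦σ app (lam (app (lam (renC (liftR suc) N)) M)) L

-- Reflexive–transitive closure of ↦βcσ, indexed by the number of βc steps.
data _↦βcσ*[_]_ {n : ℕ} : Comp n → ℕ → Comp n → Set where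
  done  : ∀ {M} → M ↦βcσ*[ zero ] M
  stepβ : ∀ {M M′ N k} → M ↦βc M′ → M′ ↦βcσ*[ k ] N → M ↦βcσ*[ suc k ] N
  stepσ : ∀ {M M′ N k} → M ↦σ M′ → M′ ↦βcσ*[ k ] N → M ↦βcσ*[ k ] N

-- Weak βc reduction: closure of βc under weak contexts W ::= [ ] | V W.
data _→wβc_ {n : ℕ} : Comp n → Comp n → Set where
  root : ∀ {M N} → M ↦βc N → M →wβc N
  appR : ∀ {V M N} → M →wβc N → app V M →wβc app V N

data _→wβc*[_]_ {n : ℕ} : Comp n → ℕ → Comp n → Set where
  done : ∀ {M} → M →wβc*[ zero ] M
  step : ∀ {M M′ N k} → M →wβc M′ → M′ →wβc*[ k ] N → M →wβc*[ suc k ] N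

-- A weak βc reduction of M to a value !W yields a big-step evaluation
-- M ⇓ W, where M₁ ⇓ U₁ and P{U₁/x} ⇓ W give (λx.P)M₁ ⇓ W.  Such a derivation is
-- replayed with root steps only: (λy.N)((λx.P)M₁) is rotated by σ into
-- (λx.(λy.N)P)M₁, M₁ is evaluated first, and after the βc step the
-- continuation (λy.N)(P{U₁/x}) is again of the same shape.  Only σ steps are
-- added, so the number of βc steps is preserved.
module Submission where

open import Defs
open import Data.Nat using (ℕ; zero; suc; _+_)
open import Data.Nat.Properties using (+-assoc)
open import Data.Fin using (zero; suc)
open import Relation.Binary.PropositionalEquality
  using (_≡_; refl; cong; cong₂; sym)

mutual
  subV∘renV-id : ∀ {m n} {ρ : Ren n m} {s : Sub m n} →
    (∀ i → s (ρ i) ≡ var i) → ∀ V → subV s (renV ρ V) ≡ V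
  subV∘renV-id e (var i) = e i
  subV∘renV-id {ρ = ρ} {s} e (lam M) = cong lam (subC∘renC-id inverse-under-binder M)
    where
    inverse-under-binder : ∀ i → liftS s (liftR ρ i) ≡ var i
    inverse-under-binder zero    = refl
    inverse-under-binder (suc i) = cong (renV suc) (e i)

  subC∘renC-id : ∀ {m n} {ρ : Ren n m} {s : Sub m n} →
    (∀ i → s (ρ i) ≡ var i) → ∀ M → subC s (renC ρ M) ≡ M
  subC∘renC-id e (ret V)   = cong ret (subV∘renV-id e V)
  subC∘renC-id e (app V M) = cong₂ app (subV∘renV-id e V) (subC∘renC-id e M)

subC-liftS-single-weaken : ∀ {n} (N : Comp (suc n)) (U : Val n) →
  subC (liftS (single U)) (renC (liftR suc) N) ≡ N
subC-liftS-single-weaken N U = subC∘renC-id single-weaken N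
  where
  single-weaken : ∀ i → liftS (single U) (liftR suc i) ≡ var i
  single-weaken zero    = refl
  single-weaken (suc i) = refl

data _⇓[_]_ {n : ℕ} : Comp n → ℕ → Val n → Set where
  ret⇓ : ∀ {V} → ret V ⇓[ zero ] V
  app⇓ : ∀ {M P U V k₁ k₂} → M ⇓[ k₁ ] U → (P [ U ]) ⇓[ k₂ ] V →
         app (lam P) M ⇓[ k₁ + suc k₂ ] V

→wβc-expands-⇓ : ∀ {n} {M M′ : Comp n} {V k} →
  M →wβc M′ → M′ ⇓[ k ] V → M ⇓[ suc k ] V
→wβc-expands-⇓ (root (βc P U)) d              = app⇓ ret⇓ d
→wβc-expands-⇓ (appR s)        (app⇓ d₁ d₂) = app⇓ (→wβc-expands-⇓ s d₁) d₂

→wβc*-ret⇒⇓ : ∀ {n} {M : Comp n} {W k} → M →wβc*[ k ] ret W → M ⇓[ k ] W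
→wβc*-ret⇒⇓ done       = ret⇓
→wβc*-ret⇒⇓ (step s r) = →wβc-expands-⇓ s (→wβc*-ret⇒⇓ r)

↦βcσ*-cast : ∀ {n} {M N : Comp n} {j k} → j ≡ k → M ↦βcσ*[ j ] N → M ↦βcσ*[ k ] N
↦βcσ*-cast refl r = r

⇓-then-↦βcσ* : ∀ {n} {M : Comp n} {U W k j} (N : Comp (suc n)) →
  M ⇓[ k ] U → (N [ U ]) ↦βcσ*[ j ] ret W → app (lam N) M ↦βcσ*[ k + suc j ] ret W
⇓-then-↦βcσ* N (ret⇓ {V = U}) r = stepβ (βc N U) r
⇓-then-↦βcσ* {W = W} {j = j} N (app⇓ {M = M₁} {P} {U₁} {k₁ = k₁} {k₂} d₁ d₂) r =
  stepσ (σ N P M₁)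
    (↦βcσ*-cast (sym (+-assoc k₁ (suc k₂) (suc j)))
      (⇓-then-↦βcσ* (app (lam (renC (liftR suc) N)) P) d₁ continuation))
  where
  continuation : (app (lam (renC (liftR suc) N)) P [ U₁ ]) ↦βcσ*[ k₂ + suc j ] ret W
  continuation rewrite subC-liftS-single-weaken N U₁ = ⇓-then-↦βcσ* N d₂ r

⇓⇒↦βcσ* : ∀ {n} {M : Comp n} {W k} → M ⇓[ k ] W → M ↦βcσ*[ k ] ret W
⇓⇒↦βcσ* ret⇓                 = done
⇓⇒↦βcσ* (app⇓ {P = P} d₁ d₂) = ⇓-then-↦βcσ* P d₁ (⇓⇒↦βcσ* d₂)

mainTheorem13 : ∀ {n : ℕ} (M : Comp n) (W : Val n) (k : ℕ) →
    M →wβc*[ k ] ret W → M ↦βcσ*[ k ] ret W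
mainTheorem13 M W k r = ⇓⇒↦βcσ* (→wβc*-ret⇒⇓ r)
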